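{- Let $\mathbf{v}_0\to\mathbf{v}_1\to\dots\to\mathbf{v}_\ell$ be a sequence of codes in $\mathbb{N}^n$ with $\mathbf{v}_i\in\Phi_{\mathbf{v}_{i-1}}$ for all $i\in[\ell]$. If none of the $\mathbf{v}_i$ is anti-dominant, then $\ell\le n\cdot(|\mathbf{v}_0|^2+|\mathbf{v}_0|)$.
   Context: A code is $\mathbf{v}=(v_1,\dots,v_n)\in\mathbb{N}^n$, identified with its extensions by trailing zeros; $|\mathbf{v}|=\sum v_i$. $\mathbf{v}$ is anti-dominant if for some $k$, $v_1\le v_2\le\dots\le v_k$ and $v_{k+1}=\dots=v_n=0$. Lehmer code: for $\sigma\in S_N$, its code has $v_i=|\{j>i:\sigma(j)<\sigma(i)\}|$; this gives a bijection between codes and permutations, $\langle\mathbf{v}\rangle$ denoting the permutation with code $\mathbf{v}$. For $i<k$, $\sigma\tau_{ik}$ is $\sigma$ with the values at positions $i,k$ exchanged. For a nonzero code $\mathbf{v}\in\mathbb{N}^n$, let $k$ be the largest index with $v_k\ne0$, $\mathbf{v}'=(v_1,\dots,v_{k-1},v_k-1,0,\dots,0)$ and $\sigma=\langle\mathbf{v}'\rangle$. $\Psi_{\mathbf{v}}$ is the set of codes $\mathbf{u}$ with $\langle\mathbf{u}\rangle=\sigma\tau_{ik}$ for some $i<k$ such that $\sigma(i)<\sigma(k)$ and for every $j$ with $i<j<k$ either $\sigma(j)>\sigma(k)$ or $\sigma(j)<\sigma(i)$ (equivalently, $|\mathbf{u}|=|\mathbf{v}|$); these are the codes in the Lascoux–Schützenberger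 transition formula $Y_{\mathbf{v}}=x_kY_{\mathbf{v}'}+\sum_{\mathbf{u}\in\Psi_{\mathbf{v}}}Y_{\mathbf{u}}$. Finally $\Phi_{\mathbf{v}}=\Psi_{\mathbf{v}}\cup\{\mathbf{v}'\}$. -}

module Defs where

open import Data.Nat using (ℕ; zero; suc; _+_; _*_; _∸_; _≤_; _<_)
open import Data.Fin using (Fin; toℕ)
open import Data.Fin.Properties using () renaming (_<?_ to _<ᶠ?_)
open import Data.Fin.Permutation using (Permutation′; _⟨$⟩ʳ_; transpose; _∘ₚ_)
open import Data.List using (length; filter; allFin)
open import Data.Vec using (Vec; lookup; sum)
open import Data.Product using (Σ; ∃; _×_; _,_)
open import Data.Sum using (_⊎_)
open import Relation.Nullary using (¬_)
open import Relation.Nullary.Decidable using (_×-dec_)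
open import Relation.Binary.PropositionalEquality using (_≡_; _≢_)
open import Data.Nat.Properties using (_<?_)
open import Relation.Nullary using (yes; no)

-- Conventions: positions are 0-based (position p here = position p+1 in the paper).
-- A code v ∈ ℕ^n is a Vec ℕ n; it is identified with its extension by zeros,
-- i.e. with the function ℕ → ℕ below.
ext : ∀ {n} → Vec ℕ n → ℕ → ℕ
ext {n} v m with m <? n
... | yes m<n = lookup v (Data.Fin.fromℕ< m<n)
... | no _ = 0

∣_∣ᶜ : ∀ {n} → Vec ℕ n → ℕ
∣ v ∣ᶜ = sum v

AntiDominant : ∀ {n} → Vec ℕ n → Set
AntiDominant {n} v = Σ ℕ λ k → k ≤ n
  × (∀ i → suc i < k → ext v i ≤ ext v (suc i))
  × (∀ i → k ≤ i → i < n → ext v i ≡ 0)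

lehmerAt : ∀ {N} → Permutation′ N → Fin N → ℕ
lehmerAt {N} σ i =
  length (filter (λ j → (i <ᶠ? j) ×-dec ((σ ⟨$⟩ʳ j) <ᶠ? (σ ⟨$⟩ʳ i))) (allFin N))

IsCodeOf : ∀ {N} → Permutation′ N → (ℕ → ℕ) → Set
IsCodeOf {N} σ c = (∀ (i : Fin N) → lehmerAt σ i ≡ c (toℕ i)) × (∀ m → N ≤ m → c m ≡ 0)

IsLastNonzero : ∀ {n} → Vec ℕ n → ℕ → Set
IsLastNonzero {n} v k = k < n × ext v k ≢ 0 × (∀ j → k < j → ext v j ≡ 0)

prime : ∀ {n} → Vec ℕ n → ℕ → (ℕ → ℕ)
prime v k m with m <? k
... | yes _ = ext v m
... | no _ with m Data.Nat.≟ k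
...   | yes _ = ext v k ∸ 1
...   | no _ = 0

-- u ∈ Ψ_v : with k the last nonzero index of v and σ = ⟨v'⟩ (in some S_N),
-- ⟨u⟩ = σ τ_{ik} for some i < k with σ(i) < σ(k) and, for all i < j < k,
-- σ(j) > σ(k) or σ(j) < σ(i).
InΨ : ∀ {n} → Vec ℕ n → Vec ℕ n → Set
InΨ {n} v u = Σ ℕ λ k → IsLastNonzero v k ×
  Σ ℕ λ N → Σ (Permutation′ N) λ σ → IsCodeOf σ (prime v k) ×
  Σ (Fin N) λ i → Σ (Fin N) λ kf → toℕ kf ≡ k × toℕ i < k ×
    Data.Fin._<_ (σ ⟨$⟩ʳ i) (σ ⟨$⟩ʳ kf) ×
    (∀ (j : Fin N) → toℕ i < toℕ j → toℕ j < k →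
       Data.Fin._<_ (σ ⟨$⟩ʳ kf) (σ ⟨$⟩ʳ j) ⊎ Data.Fin._<_ (σ ⟨$⟩ʳ j) (σ ⟨$⟩ʳ i)) ×
    -- (transpose i kf ∘ₚ σ) ⟨$⟩ʳ x = σ(τ_{ik}(x)), i.e. the permutation σ τ_{ik}
    IsCodeOf (transpose i kf ∘ₚ σ) (ext u)

InΦ : ∀ {n} → Vec ℕ n → Vec ℕ n → Set
InΦ {n} v u = InΨ v u ⊎ (Σ ℕ λ k → IsLastNonzero v k × (∀ m → ext u m ≡ prime v k m))

-- The weight Σₘ m·vₘ of a code strictly decreases along every arrow v → u whose source is
-- not anti-dominant, and the weight of v₀ is at most n·|v₀|; hence ℓ ≤ n·|v₀|.
-- For u = v′ the weight drops by the last nonzero position k, and k > 0 because a code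
-- supported on position 0 is anti-dominant. For u ∈ Ψ_v the code of στ_{ik} agrees with v′
-- outside {i, k}, has u_i + u_k = v′_i + v′_k + 1 and u_k ≤ v′_k (both equalities use the
-- condition on σ(j) for i < j < k), so u arises from v by moving mass from position k down
-- to position i < k.
module Submission where

open import Defs
open import Data.Nat using (ℕ; zero; suc; _+_; _*_; _∸_; _^_; _≤_; _<_; z≤n; s≤s; _≟_)
open import Data.Nat.Properties
open import Data.Nat.Tactic.RingSolver using (solve-∀)
open import Algebra.Properties.CommutativeSemigroup +-commutativeSemigroup using (xy∙z≈xz∙y; xy∙z≈zy∙x)
open import Algebra.Properties.Semiring.Sum +-*-semiring
  using (sum; sum-syntax; sum-cong-≗; sum-remove; ∑-distrib-+; *-distribˡ-sum)
open import Data.Fin as Fin using (Fin; toℕ; fromℕ<) renaming (_<_ to _<ᶠ_; _≟_ to _≟ᶠ_)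
open import Data.Fin.Properties as Finₚ
  using (punchInᵢ≢i; toℕ-fromℕ<; fromℕ<-toℕ; toℕ<n; toℕ-injective) renaming (_<?_ to _<ᶠ?_)
open import Data.Fin.Permutation using (Permutation′; _⟨$⟩ʳ_; transpose; _∘ₚ_)
import Data.Fin.Permutation.Components as PC
open import Data.Vec using (Vec; []; _∷_; lookup)
import Data.Vec as Vec
open import Data.Vec.Functional using (removeAt; updateAt)
open import Data.Vec.Functional.Properties using (updateAt-updates; updateAt-minimal)
open import Data.List using (length; filter; tabulate)
open import Data.Product using (_×_; _,_; proj₁)
open import Data.Sum using (_⊎_; inj₁; inj₂)
open import Data.Empty using (⊥-elim)
open import Function using (_∘_; id; const)
open import Relation.Nullary using (Dec; yes; no; ¬_)
open import Relation.Nullary.Decidable using (_×-dec_; dec-true; dec-false)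
open import Relation.Unary using (Decidable)
open import Relation.Binary.Definitions using (tri<; tri≈; tri>)
open import Relation.Binary.PropositionalEquality

𝟙 : ∀ {a} {A : Set a} → Dec A → ℕ
𝟙 (yes _) = 1
𝟙 (no _) = 0

𝟙-yes : ∀ {a} {A : Set a} (d : Dec A) → A → 𝟙 d ≡ 1
𝟙-yes (yes _) _ = refl
𝟙-yes (no ¬a) a = ⊥-elim (¬a a)

𝟙-no : ∀ {a} {A : Set a} (d : Dec A) → ¬ A → 𝟙 d ≡ 0
𝟙-no (yes a) ¬a = ⊥-elim (¬a a)
𝟙-no (no _) _ = refl

𝟙-mono : ∀ {a b} {A : Set a} {B : Set b} (d : Dec A) (e : Dec B) → (A → B) → 𝟙 d ≤ 𝟙 e
𝟙-mono (yes a) (yes _) _ = ≤-refl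
𝟙-mono (yes a) (no ¬b) f = ⊥-elim (¬b (f a))
𝟙-mono (no _) _ _ = z≤n

𝟙-cong : ∀ {a b} {A : Set a} {B : Set b} (d : Dec A) (e : Dec B) → (A → B) → (B → A) → 𝟙 d ≡ 𝟙 e
𝟙-cong d e f g = ≤-antisym (𝟙-mono d e f) (𝟙-mono e d g)

length-filter-tabulate : ∀ {a p} {A : Set a} {P : A → Set p} (P? : Decidable P) {N} (f : Fin N → A) →
  length (filter P? (tabulate f)) ≡ ∑[ x < N ] 𝟙 (P? (f x))
length-filter-tabulate P? {zero} f = refl
length-filter-tabulate P? {suc N} f with P? (f Fin.zero)
... | yes _ = cong suc (length-filter-tabulate P? (f ∘ Fin.suc))
... | no _ = length-filter-tabulate P? (f ∘ Fin.suc)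

sum-mono-≤ : ∀ {N} {f g : Fin N → ℕ} → (∀ x → f x ≤ g x) → sum f ≤ sum g
sum-mono-≤ {zero} f≤g = z≤n
sum-mono-≤ {suc N} f≤g = +-mono-≤ (f≤g Fin.zero) (sum-mono-≤ (f≤g ∘ Fin.suc))

sum-differAt : ∀ {N} (f g : Fin N → ℕ) a → (∀ x → x ≢ a → f x ≡ g x) →
  sum f + g a ≡ sum g + f a
sum-differAt {suc N} f g a agree = begin
  sum f + g a                     ≡⟨ cong (_+ g a) (sum-remove {i = a} f) ⟩
  f a + sum (removeAt f a) + g a  ≡⟨ cong (λ s → f a + s + g a) (sum-cong-≗ (λ x → agree _ (punchInᵢ≢i a x))) ⟩
  f a + sum (removeAt g a) + g a  ≡⟨ xy∙z≈zy∙x (f a) _ (g a) ⟩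
  g a + sum (removeAt g a) + f a  ≡⟨ cong (_+ f a) (sum-remove {i = a} g) ⟨
  sum g + f a                     ∎
  where open ≡-Reasoning

sum-differAt₂ : ∀ {N} (f g : Fin N → ℕ) a b → a ≢ b → (∀ x → x ≢ a → x ≢ b → f x ≡ g x) →
  sum f + (g a + g b) ≡ sum g + (f a + f b)
sum-differAt₂ f g a b a≢b agree = begin
  sum f + (g a + g b)  ≡⟨ +-assoc (sum f) (g a) (g b) ⟨
  sum f + g a + g b    ≡⟨ cong (λ y → sum f + y + g b) (updateAt-updates a f) ⟨
  sum f + h a + g b    ≡⟨ cong (_+ g b) (sum-differAt f h a f≡h) ⟩
  sum h + f a + g b    ≡⟨ xy∙z≈xz∙y (sum h) (f a) (g b) ⟩
  sum h + g b + f a    ≡⟨ cong (_+ f a) (sum-differAt h g b h≡g) ⟩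
  sum g + h b + f a    ≡⟨ cong (λ y → sum g + y + f a) (updateAt-minimal b a f (a≢b ∘ sym)) ⟩
  sum g + f b + f a    ≡⟨ +-assoc (sum g) (f b) (f a) ⟩
  sum g + (f b + f a)  ≡⟨ cong (sum g +_) (+-comm (f b) (f a)) ⟩
  sum g + (f a + f b)  ∎
  where
  open ≡-Reasoning
  h : Fin _ → ℕ
  h = updateAt f a (const (g a))
  f≡h : ∀ x → x ≢ a → f x ≡ h x
  f≡h x x≢a = sym (updateAt-minimal x a f x≢a)
  h≡g : ∀ x → x ≢ b → h x ≡ g x
  h≡g x x≢b with x ≟ᶠ a
  ... | yes refl = updateAt-updates a f
  ... | no x≢a = trans (updateAt-minimal x a f x≢a) (agree x x≢a x≢b)

fromℕ<-≢ : ∀ {n m} (p : m < n) {x : Fin n} → x ≢ fromℕ< p → toℕ x ≢ m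
fromℕ<-≢ p x≢ toℕx≡m = x≢ (toℕ-injective (trans toℕx≡m (sym (toℕ-fromℕ< p))))

weight : ℕ → (ℕ → ℕ) → ℕ
weight n c = ∑[ m < n ] (toℕ m * c (toℕ m))

weight-differAt : ∀ n (c d : ℕ → ℕ) {a} → a < n → (∀ m → m ≢ a → d m ≡ c m) →
  weight n d + a * c a ≡ weight n c + a * d a
weight-differAt n c d {a} a<n agree =
  subst₂ (λ x y → weight n d + x ≡ weight n c + y) (atA c) (atA d)
    (sum-differAt _ _ (fromℕ< a<n) (λ x x≢a → cong (toℕ x *_) (agree (toℕ x) (fromℕ<-≢ a<n x≢a))))
  where
  atA : ∀ e → toℕ (fromℕ< a<n) * e (toℕ (fromℕ< a<n)) ≡ a * e a
  atA e = cong (λ m → m * e m) (toℕ-fromℕ< a<n)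

weight-differAt₂ : ∀ n (c d : ℕ → ℕ) {a b} → a < n → b < n → a ≢ b →
  (∀ m → m ≢ a → m ≢ b → d m ≡ c m) →
  weight n d + (a * c a + b * c b) ≡ weight n c + (a * d a + b * d b)
weight-differAt₂ n c d {a} {b} a<n b<n a≢b agree =
  subst₂ (λ x y → weight n d + x ≡ weight n c + y) (atAB c) (atAB d)
    (sum-differAt₂ _ _ (fromℕ< a<n) (fromℕ< b<n) (λ e → a≢b (toℕ-fromℕ<-≡ e))
      (λ x x≢a x≢b → cong (toℕ x *_) (agree (toℕ x) (fromℕ<-≢ a<n x≢a) (fromℕ<-≢ b<n x≢b))))
  where
  toℕ-fromℕ<-≡ : fromℕ< a<n ≡ fromℕ< b<n → a ≡ b
  toℕ-fromℕ<-≡ e = trans (sym (toℕ-fromℕ< a<n)) (trans (cong toℕ e) (toℕ-fromℕ< b<n))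
  atAB : ∀ e → toℕ (fromℕ< a<n) * e (toℕ (fromℕ< a<n)) + toℕ (fromℕ< b<n) * e (toℕ (fromℕ< b<n))
             ≡ a * e a + b * e b
  atAB e = cong₂ (λ x y → x * e x + y * e y) (toℕ-fromℕ< a<n) (toℕ-fromℕ< b<n)

weight-decrement : ∀ n (c d : ℕ → ℕ) {k} → k < n → (∀ m → m ≢ k → d m ≡ c m) →
  suc (d k) ≡ c k → weight n d + k ≡ weight n c
weight-decrement n c d {k} k<n agree 1+dk≡ck = +-cancelʳ-≡ (k * d k) _ _ (begin
  weight n d + k + k * d k    ≡⟨ +-assoc (weight n d) k (k * d k) ⟩
  weight n d + (k + k * d k)  ≡⟨ cong (weight n d +_) (*-suc k (d k)) ⟨
  weight n d + k * suc (d k)  ≡⟨ cong (λ y → weight n d + k * y) 1+dk≡ck ⟩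
  weight n d + k * c k        ≡⟨ weight-differAt n c d k<n agree ⟩
  weight n c + k * d k        ∎)
  where open ≡-Reasoning

shiftLeft-< : ∀ {a b ca cb da db} → a < b → da + db ≡ ca + cb → db < cb →
  a * da + b * db < a * ca + b * cb
shiftLeft-< {a} {b} {ca} {cb} {da} {db} a<b sum≡ db<cb with m≤n⇒∃[o]m+o≡n db<cb
... | o , refl = begin-strict
  a * da + b * db                   ≡⟨ cong (λ x → a * x + b * db) da≡ca+t ⟩
  a * (ca + t) + b * db             ≡⟨ lhs a b ca db t ⟩
  (a * ca + b * db) + a * t         <⟨ +-monoʳ-< (a * ca + b * db) (*-monoˡ-< t a<b) ⟩
  (a * ca + b * db) + b * t         ≡⟨ rhs a b ca db o ⟨
  a * ca + b * (suc db + o)         ∎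
  where
  open ≤-Reasoning
  t = suc o
  lhs : ∀ a b ca db t → a * (ca + t) + b * db ≡ (a * ca + b * db) + a * t
  lhs = solve-∀
  rhs : ∀ a b ca db o → a * ca + b * (suc db + o) ≡ (a * ca + b * db) + b * suc o
  rhs = solve-∀
  shuffle : ∀ ca db o → ca + (suc db + o) ≡ ca + suc o + db
  shuffle = solve-∀
  da≡ca+t : da ≡ ca + t
  da≡ca+t = +-cancelʳ-≡ db _ _ (trans sum≡ (shuffle ca db o))

weight-shiftLeft : ∀ n (c d : ℕ → ℕ) {a b} → a < b → b < n →
  (∀ m → m ≢ a → m ≢ b → d m ≡ c m) → d a + d b ≡ c a + c b → d b < c b →
  weight n d < weight n c
weight-shiftLeft n c d {a} {b} a<b b<n agree sum≡ db<cb = +-cancelʳ-< _ (weight n d) (weight n c) (begin-strict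
  weight n d + (a * c a + b * c b)  ≡⟨ weight-differAt₂ n c d (<-trans a<b b<n) b<n (<⇒≢ a<b) agree ⟩
  weight n c + (a * d a + b * d b)  <⟨ +-monoʳ-< (weight n c) (shiftLeft-< a<b sum≡ db<cb) ⟩
  weight n c + (a * c a + b * c b)  ∎)
  where open ≤-Reasoning

ext-lookup : ∀ {n} (v : Vec ℕ n) (m : Fin n) → ext v (toℕ m) ≡ lookup v m
ext-lookup {n} v m with toℕ m <? n
... | yes p = cong (lookup v) (fromℕ<-toℕ m p)
... | no ¬p = ⊥-elim (¬p (toℕ<n m))

sum-lookup : ∀ {n} (v : Vec ℕ n) → sum (lookup v) ≡ Vec.sum v
sum-lookup [] = refl
sum-lookup (x ∷ v) = cong (x +_) (sum-lookup v)

weight-≤ : ∀ {n} (v : Vec ℕ n) → weight n (ext v) ≤ n * ∣ v ∣ᶜ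
weight-≤ {n} v = begin
  weight n (ext v)             ≤⟨ sum-mono-≤ (λ m → *-mono-≤ (<⇒≤ (toℕ<n m)) (≤-reflexive (ext-lookup v m))) ⟩
  ∑[ m < n ] (n * lookup v m)  ≡⟨ *-distribˡ-sum n (lookup v) ⟨
  n * sum (lookup v)           ≡⟨ cong (n *_) (sum-lookup v) ⟩
  n * ∣ v ∣ᶜ                   ∎
  where open ≤-Reasoning

Inversion : ∀ {N} → Permutation′ N → Fin N → Fin N → Set
Inversion π j x = j <ᶠ x × π ⟨$⟩ʳ x <ᶠ π ⟨$⟩ʳ j

inversion? : ∀ {N} (π : Permutation′ N) j x → Dec (Inversion π j x)
inversion? π j x = (j <ᶠ? x) ×-dec ((π ⟨$⟩ʳ x) <ᶠ? (π ⟨$⟩ʳ j))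

lehmerAt-∑ : ∀ {N} (π : Permutation′ N) j → lehmerAt π j ≡ ∑[ x < N ] 𝟙 (inversion? π j x)
lehmerAt-∑ π j = length-filter-tabulate (inversion? π j) id

inversion-≮ : ∀ {N} (π : Permutation′ N) {j x} → ¬ j <ᶠ x → 𝟙 (inversion? π j x) ≡ 0
inversion-≮ π {j} {x} j≮x = 𝟙-no (inversion? π j x) (j≮x ∘ proj₁)

module Transposition {N} (σ : Permutation′ N) {i k : Fin N} (i<k : i <ᶠ k)
  (σi<σk : σ ⟨$⟩ʳ i <ᶠ σ ⟨$⟩ʳ k)
  (gap : ∀ j → i <ᶠ j → j <ᶠ k → σ ⟨$⟩ʳ k <ᶠ σ ⟨$⟩ʳ j ⊎ σ ⟨$⟩ʳ j <ᶠ σ ⟨$⟩ʳ i) where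

  σ′ : Permutation′ N
  σ′ = transpose i k ∘ₚ σ

  τ : Fin N → Fin N
  τ = PC.transpose i k

  k≢i : k ≢ i
  k≢i = Finₚ.<⇒≢ i<k ∘ sym

  τ-i : τ i ≡ k
  τ-i rewrite dec-true (i ≟ᶠ i) refl = refl

  τ-k : τ k ≡ i
  τ-k rewrite dec-false (k ≟ᶠ i) k≢i | dec-true (k ≟ᶠ k) refl = refl

  τ-other : ∀ {x} → x ≢ i → x ≢ k → τ x ≡ x
  τ-other {x} x≢i x≢k rewrite dec-false (x ≟ᶠ i) x≢i | dec-false (x ≟ᶠ k) x≢k = refl

  gap-above : ∀ {j} → i <ᶠ j → j <ᶠ k → σ ⟨$⟩ʳ i <ᶠ σ ⟨$⟩ʳ j → σ ⟨$⟩ʳ k <ᶠ σ ⟨$⟩ʳ j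
  gap-above {j} i<j j<k σi<σj with gap j i<j j<k
  ... | inj₁ σk<σj = σk<σj
  ... | inj₂ σj<σi = ⊥-elim (Finₚ.<-asym σi<σj σj<σi)

  gap-below : ∀ {j} → i <ᶠ j → j <ᶠ k → σ ⟨$⟩ʳ j <ᶠ σ ⟨$⟩ʳ k → σ ⟨$⟩ʳ j <ᶠ σ ⟨$⟩ʳ i
  gap-below {j} i<j j<k σj<σk with gap j i<j j<k
  ... | inj₁ σk<σj = ⊥-elim (Finₚ.<-asym σj<σk σk<σj)
  ... | inj₂ σj<σi = σj<σi

  ⟦_<_∧_≺_⟧? : (j x a b : Fin N) → Dec (j <ᶠ x × σ ⟨$⟩ʳ a <ᶠ σ ⟨$⟩ʳ b)
  ⟦ j < x ∧ a ≺ b ⟧? = (j <ᶠ? x) ×-dec ((σ ⟨$⟩ʳ a) <ᶠ? (σ ⟨$⟩ʳ b))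

  ⟦_<_∧_≺_⟧ : Fin N → Fin N → Fin N → Fin N → ℕ
  ⟦ j < x ∧ a ≺ b ⟧ = 𝟙 ⟦ j < x ∧ a ≺ b ⟧?

  inv′ : ∀ j x {a b} → τ x ≡ a → τ j ≡ b → 𝟙 (inversion? σ′ j x) ≡ ⟦ j < x ∧ a ≺ b ⟧
  inv′ j x refl refl = refl

  lehmerAt-other : ∀ {j} → j ≢ i → j ≢ k → lehmerAt σ′ j ≡ lehmerAt σ j
  lehmerAt-other {j} j≢i j≢k = begin
    lehmerAt σ′ j  ≡⟨ lehmerAt-∑ σ′ j ⟩
    sum E′         ≡⟨ +-cancelʳ-≡ _ _ _
                        (trans (sum-differAt₂ E′ E i k (k≢i ∘ sym) agree) (cong (sum E +_) ends)) ⟩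
    sum E          ≡⟨ lehmerAt-∑ σ j ⟨
    lehmerAt σ j   ∎
    where
    open ≡-Reasoning
    E E′ : Fin N → ℕ
    E  x = 𝟙 (inversion? σ j x)
    E′ x = 𝟙 (inversion? σ′ j x)
    agree : ∀ x → x ≢ i → x ≢ k → E′ x ≡ E x
    agree x x≢i x≢k = inv′ j x (τ-other x≢i x≢k) (τ-other j≢i j≢k)
    swapped : ⟦ j < i ∧ k ≺ j ⟧ + ⟦ j < k ∧ i ≺ j ⟧ ≡ ⟦ j < i ∧ i ≺ j ⟧ + ⟦ j < k ∧ k ≺ j ⟧
    swapped with Finₚ.<-cmp j i
    ... | tri< j<i _ _ = trans (+-comm ⟦ j < i ∧ k ≺ j ⟧ _) (cong₂ _+_
          (𝟙-cong ⟦ j < k ∧ i ≺ j ⟧? ⟦ j < i ∧ i ≺ j ⟧?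
            (λ (_ , σi<σj) → j<i , σi<σj) (λ (_ , σi<σj) → j<k , σi<σj))
          (𝟙-cong ⟦ j < i ∧ k ≺ j ⟧? ⟦ j < k ∧ k ≺ j ⟧?
            (λ (_ , σk<σj) → j<k , σk<σj) (λ (_ , σk<σj) → j<i , σk<σj)))
      where j<k = Finₚ.<-trans j<i i<k
    ... | tri≈ _ j≡i _ = ⊥-elim (j≢i j≡i)
    ... | tri> j≮i _ i<j = cong₂ _+_
          (trans (𝟙-no ⟦ j < i ∧ k ≺ j ⟧? (j≮i ∘ proj₁)) (sym (𝟙-no ⟦ j < i ∧ i ≺ j ⟧? (j≮i ∘ proj₁))))
          (𝟙-cong ⟦ j < k ∧ i ≺ j ⟧? ⟦ j < k ∧ k ≺ j ⟧?
            (λ (j<k , σi<σj) → j<k , gap-above i<j j<k σi<σj) (λ (j<k , σk<σj) → j<k , Finₚ.<-trans σi<σk σk<σj))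
    ends : E′ i + E′ k ≡ E i + E k
    ends = trans (cong₂ _+_ (inv′ j i τ-i (τ-other j≢i j≢k)) (inv′ j k τ-k (τ-other j≢i j≢k))) swapped

  lehmerAt-k-≤ : lehmerAt σ′ k ≤ lehmerAt σ k
  lehmerAt-k-≤ = subst₂ _≤_ (sym (lehmerAt-∑ σ′ k)) (sym (lehmerAt-∑ σ k)) (sum-mono-≤ pointwise)
    where
    τ-right : ∀ {x} → k <ᶠ x → τ x ≡ x
    τ-right k<x = τ-other (λ { refl → Finₚ.<-asym i<k k<x }) (λ { refl → Finₚ.<-irrefl refl k<x })
    pointwise : ∀ x → 𝟙 (inversion? σ′ k x) ≤ 𝟙 (inversion? σ k x)
    pointwise x = ≤-trans (≤-reflexive (inv′ k x refl τ-k)) (𝟙-mono ⟦ k < x ∧ τ x ≺ i ⟧? (inversion? σ k x)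
      (λ (k<x , στx<σi) → k<x , Finₚ.<-trans (subst (λ y → σ ⟨$⟩ʳ y <ᶠ σ ⟨$⟩ʳ i) (τ-right k<x) στx<σi) σi<σk))

  lehmerAt-i+k : lehmerAt σ′ i + lehmerAt σ′ k ≡ suc (lehmerAt σ i + lehmerAt σ k)
  lehmerAt-i+k = begin
    lehmerAt σ′ i + lehmerAt σ′ k      ≡⟨ cong₂ _+_ (lehmerAt-∑ σ′ i) (lehmerAt-∑ σ′ k) ⟩
    sum (E σ′ i) + sum (E σ′ k)        ≡⟨ ∑-distrib-+ (E σ′ i) (E σ′ k) ⟨
    sum F′                             ≡⟨ +-identityʳ (sum F′) ⟨
    sum F′ + 0                         ≡⟨ cong (sum F′ +_) F-k ⟨
    sum F′ + F k                       ≡⟨ sum-differAt F′ F k agree ⟩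
    sum F + F′ k                       ≡⟨ cong (sum F +_) F′-k ⟩
    sum F + 1                          ≡⟨ +-comm (sum F) 1 ⟩
    suc (sum F)                        ≡⟨ cong suc (∑-distrib-+ (E σ i) (E σ k)) ⟩
    suc (sum (E σ i) + sum (E σ k))    ≡⟨ cong suc (cong₂ _+_ (lehmerAt-∑ σ i) (lehmerAt-∑ σ k)) ⟨
    suc (lehmerAt σ i + lehmerAt σ k)  ∎
    where
    open ≡-Reasoning
    E : Permutation′ N → Fin N → Fin N → ℕ
    E π j x = 𝟙 (inversion? π j x)
    F F′ : Fin N → ℕ
    F  x = E σ i x + E σ k x
    F′ x = E σ′ i x + E σ′ k x
    F-k : F k ≡ 0
    F-k = cong₂ _+_ (𝟙-no (inversion? σ i k) (λ (_ , σk<σi) → Finₚ.<-asym σk<σi σi<σk))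
                    (inversion-≮ σ (Finₚ.<-irrefl refl))
    F′-k : F′ k ≡ 1
    F′-k = cong₂ _+_ (trans (inv′ i k τ-k τ-i) (𝟙-yes ⟦ i < k ∧ i ≺ k ⟧? (i<k , σi<σk)))
                     (inversion-≮ σ′ (Finₚ.<-irrefl refl))
    middle : ∀ {x} → i <ᶠ x → x <ᶠ k → ⟦ i < x ∧ x ≺ k ⟧ ≡ ⟦ i < x ∧ x ≺ i ⟧
    middle {x} i<x x<k = 𝟙-cong ⟦ i < x ∧ x ≺ k ⟧? ⟦ i < x ∧ x ≺ i ⟧?
      (λ (_ , σx<σk) → i<x , gap-below i<x x<k σx<σk) (λ (_ , σx<σi) → i<x , Finₚ.<-trans σx<σi σi<σk)
    agree : ∀ x → x ≢ k → F′ x ≡ F x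
    agree x x≢k with Finₚ.<-cmp i x
    ... | tri≈ _ refl _ =
      trans (cong₂ _+_ (inversion-≮ σ′ (Finₚ.<-irrefl refl)) (inversion-≮ σ′ (Finₚ.<-asym i<k)))
            (sym (cong₂ _+_ (inversion-≮ σ (Finₚ.<-irrefl refl)) (inversion-≮ σ (Finₚ.<-asym i<k))))
    ... | tri> i≮x _ _ = trans (cong₂ _+_ (inversion-≮ σ′ i≮x) (inversion-≮ σ′ (i≮x ∘ Finₚ.<-trans i<k)))
                               (sym (cong₂ _+_ (inversion-≮ σ i≮x) (inversion-≮ σ (i≮x ∘ Finₚ.<-trans i<k))))
    ... | tri< i<x i≢x _ = trans (cong₂ _+_ (inv′ i x τx τ-i) (inv′ k x τx τ-k)) regroup
      where
      τx = τ-other (i≢x ∘ sym) x≢k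
      regroup : ⟦ i < x ∧ x ≺ k ⟧ + ⟦ k < x ∧ x ≺ i ⟧ ≡ ⟦ i < x ∧ x ≺ i ⟧ + ⟦ k < x ∧ x ≺ k ⟧
      regroup with Finₚ.<-cmp x k
      ... | tri< x<k _ k≮x = cong₂ _+_ (middle i<x x<k)
            (trans (𝟙-no ⟦ k < x ∧ x ≺ i ⟧? (k≮x ∘ proj₁)) (sym (inversion-≮ σ k≮x)))
      ... | tri≈ _ x≡k _ = ⊥-elim (x≢k x≡k)
      ... | tri> _ _ k<x = trans (+-comm ⟦ i < x ∧ x ≺ k ⟧ _) (cong₂ _+_
            (𝟙-cong ⟦ k < x ∧ x ≺ i ⟧? ⟦ i < x ∧ x ≺ i ⟧?
              (λ (_ , σx<σi) → i<x , σx<σi) (λ (_ , σx<σi) → k<x , σx<σi))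
            (𝟙-cong ⟦ i < x ∧ x ≺ k ⟧? ⟦ k < x ∧ x ≺ k ⟧?
              (λ (_ , σx<σk) → k<x , σx<σk) (λ (_ , σx<σk) → i<x , σx<σk)))

prime-≢ : ∀ {n} {v : Vec ℕ n} {k} → IsLastNonzero v k → ∀ {m} → m ≢ k → prime v k m ≡ ext v m
prime-≢ {v = v} {k} (_ , _ , beyond) {m} m≢k with m <? k
... | yes _ = refl
... | no m≮k with m ≟ k
...   | yes m≡k = ⊥-elim (m≢k m≡k)
...   | no _ = sym (beyond m (≤∧≢⇒< (≮⇒≥ m≮k) (m≢k ∘ sym)))

suc-prime : ∀ {n} {v : Vec ℕ n} {k} → IsLastNonzero v k → suc (prime v k k) ≡ ext v k
suc-prime {v = v} {k} (_ , vk≢0 , _) with k <? k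
... | yes k<k = ⊥-elim (<-irrefl refl k<k)
... | no _ with k ≟ k
...   | yes _ = trans (+-comm 1 (ext v k ∸ 1)) (m∸n+n≡m (n≢0⇒n>0 vk≢0))
...   | no k≢k = ⊥-elim (k≢k refl)

lastNonzero-zero⇒antiDominant : ∀ {n} {v : Vec ℕ n} → IsLastNonzero v 0 → AntiDominant v
lastNonzero-zero⇒antiDominant (0<n , _ , beyond) = 1 , 0<n , (λ { _ (s≤s ()) }) , (λ m 1≤m _ → beyond m 1≤m)

weight-prime : ∀ {n} {v u : Vec ℕ n} {k} → IsLastNonzero v k → ¬ AntiDominant v →
  (∀ m → ext u m ≡ prime v k m) → weight n (ext u) < weight n (ext v)
weight-prime {n} {v} {u} {k} last notAD u≡v′ = begin-strict
  weight n (ext u)      <⟨ m<m+n (weight n (ext u)) 0<k ⟩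
  weight n (ext u) + k  ≡⟨ weight-decrement n (ext v) (ext u) (proj₁ last)
                             (λ m m≢k → trans (u≡v′ m) (prime-≢ last m≢k))
                             (trans (cong suc (u≡v′ k)) (suc-prime last)) ⟩
  weight n (ext v)      ∎
  where
  open ≤-Reasoning
  0<k : 0 < k
  0<k = n≢0⇒n>0 (λ { refl → notAD (lastNonzero-zero⇒antiDominant last) })

IsCodeOf-≡ : ∀ {N} {π ρ : Permutation′ N} {c d : ℕ → ℕ} → IsCodeOf π c → IsCodeOf ρ d →
  ∀ m → (∀ x → toℕ x ≡ m → lehmerAt π x ≡ lehmerAt ρ x) → c m ≡ d m
IsCodeOf-≡ {N} {π} {ρ} {c} {d} (codeπ , boundπ) (codeρ , boundρ) m same with m <? N
... | yes m<N = begin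
  c m                     ≡⟨ cong c (toℕ-fromℕ< m<N) ⟨
  c (toℕ x)               ≡⟨ codeπ x ⟨
  lehmerAt π x            ≡⟨ same x (toℕ-fromℕ< m<N) ⟩
  lehmerAt ρ x            ≡⟨ codeρ x ⟩
  d (toℕ x)               ≡⟨ cong d (toℕ-fromℕ< m<N) ⟩
  d m                     ∎
  where
  open ≡-Reasoning
  x = fromℕ< m<N
... | no m≮N = trans (boundπ m (≮⇒≥ m≮N)) (sym (boundρ m (≮⇒≥ m≮N)))

weight-Ψ : ∀ {n} {v u : Vec ℕ n} → InΨ v u → weight n (ext u) < weight n (ext v)
weight-Ψ {n} {v} {u} (_ , last , N , σ , codeσ , i , k , refl , i<k , σi<σk , gap , codeU) =
  weight-shiftLeft n (ext v) (ext u) i<k (proj₁ last) agree ends-sum uk<vk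
  where
  open Transposition σ i<k σi<σk gap
  v′ = prime v (toℕ k)
  I≢K : toℕ i ≢ toℕ k
  I≢K = <⇒≢ i<k
  agree : ∀ m → m ≢ toℕ i → m ≢ toℕ k → ext u m ≡ ext v m
  agree m m≢i m≢k = trans
    (IsCodeOf-≡ {π = σ′} {σ} {ext u} {v′} codeU codeσ m
      (λ { x refl → lehmerAt-other (m≢i ∘ cong toℕ) (m≢k ∘ cong toℕ) }))
    (prime-≢ last m≢k)
  ends-sum : ext u (toℕ i) + ext u (toℕ k) ≡ ext v (toℕ i) + ext v (toℕ k)
  ends-sum = begin
    ext u (toℕ i) + ext u (toℕ k)        ≡⟨ cong₂ _+_ (proj₁ codeU i) (proj₁ codeU k) ⟨
    lehmerAt σ′ i + lehmerAt σ′ k        ≡⟨ lehmerAt-i+k ⟩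
    suc (lehmerAt σ i + lehmerAt σ k)    ≡⟨ cong suc (cong₂ _+_ (proj₁ codeσ i) (proj₁ codeσ k)) ⟩
    suc (v′ (toℕ i) + v′ (toℕ k))        ≡⟨ +-suc (v′ (toℕ i)) (v′ (toℕ k)) ⟨
    v′ (toℕ i) + suc (v′ (toℕ k))        ≡⟨ cong₂ _+_ (prime-≢ last I≢K) (suc-prime last) ⟩
    ext v (toℕ i) + ext v (toℕ k)        ∎
    where open ≡-Reasoning
  uk<vk : ext u (toℕ k) < ext v (toℕ k)
  uk<vk = begin-strict
    ext u (toℕ k)     ≡⟨ proj₁ codeU k ⟨
    lehmerAt σ′ k     ≤⟨ lehmerAt-k-≤ ⟩
    lehmerAt σ k      ≡⟨ proj₁ codeσ k ⟩
    v′ (toℕ k)        <⟨ ≤-refl ⟩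
    suc (v′ (toℕ k))  ≡⟨ suc-prime last ⟩
    ext v (toℕ k)     ∎
    where open ≤-Reasoning

weight-Φ : ∀ {n} {v u : Vec ℕ n} → InΦ v u → ¬ AntiDominant v → weight n (ext u) < weight n (ext v)
weight-Φ (inj₁ u∈Ψ) _ = weight-Ψ u∈Ψ
weight-Φ (inj₂ (_ , last , u≡v′)) notAD = weight-prime last notAD u≡v′

descent-length : ∀ ℓ (f : ℕ → ℕ) → (∀ i → i < ℓ → f (suc i) < f i) → ℓ + f ℓ ≤ f 0
descent-length zero f _ = ≤-refl
descent-length (suc ℓ) f descends = begin
  suc ℓ + f (suc ℓ)    ≡⟨ +-suc ℓ (f (suc ℓ)) ⟨
  ℓ + suc (f (suc ℓ))  ≤⟨ +-monoʳ-≤ ℓ (descends ℓ ≤-refl) ⟩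
  ℓ + f ℓ              ≤⟨ descent-length ℓ f (λ i i<ℓ → descends i (m<n⇒m<1+n i<ℓ)) ⟩
  f 0                  ∎
  where open ≤-Reasoning

corollary5p7 : (n ℓ : ℕ) (vs : ℕ → Vec ℕ n) →
    (∀ i → i < ℓ → InΦ (vs i) (vs (suc i))) →
    (∀ i → i ≤ ℓ → ¬ AntiDominant (vs i)) →
    ℓ ≤ n * (∣ vs 0 ∣ᶜ ^ 2 + ∣ vs 0 ∣ᶜ)
corollary5p7 n ℓ vs steps notAD = begin
  ℓ                                ≤⟨ m≤m+n ℓ (W ℓ) ⟩
  ℓ + W ℓ                          ≤⟨ descent-length ℓ W W-descends ⟩
  W 0                              ≤⟨ weight-≤ (vs 0) ⟩
  n * ∣ vs 0 ∣ᶜ                    ≤⟨ *-monoʳ-≤ n (m≤n+m ∣ vs 0 ∣ᶜ (∣ vs 0 ∣ᶜ ^ 2)) ⟩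
  n * (∣ vs 0 ∣ᶜ ^ 2 + ∣ vs 0 ∣ᶜ)  ∎
  where
  open ≤-Reasoning
  W : ℕ → ℕ
  W i = weight n (ext (vs i))
  W-descends : ∀ i → i < ℓ → W (suc i) < W i
  W-descends i i<ℓ = weight-Φ (steps i i<ℓ) (notAD i (<⇒≤ i<ℓ))
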